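{- Let $f:\mathbb{N}\to\mathbb{N}$ and let $r,k\in\mathbb{N}$. Let $G$ be a graph that admits an $f$-flat decomposition of width $k$. Then \[ \mathrm{col}_r(G)\le (k+1)\cdot f(r). \]
   Context: A decomposition of $G$ is a sequence $(H_1,\ldots,H_\ell)$ of non-empty subgraphs whose vertex sets partition $V(G)$. A subgraph $H$ of a graph $G'$ $f$-spreads on $G'$ if $|N^{G'}_r[v]\cap V(H)|\le f(r)$ for every $r\in\mathbb{N}$ and every $v\in V(G')$, where $N^{G'}_r[v]$ is the set of vertices at distance at most $r$ from $v$ in $G'$. The decomposition is $f$-flat if each $H_i$ $f$-spreads on $G-\bigcup_{1\le j<i}V(H_j)$. Two vertex-disjoint subgraphs are connected if some edge joins them. For a component $C$ of $G-\bigcup_{1\le j\le i}V(H_j)$, its separating number is the number of graphs among $H_1,\ldots,H_i$ connected to $C$; the width of the decomposition is the maximum separating number of a component of $G-\bigcup_{1\le j<i}V(H_j)$ over all $1\le i\le\ell$. For a linear order $L$ of $V(G)$, $u$ is strongly $r$-reachable from $v$ if there is a path of length at most $r$ between $u$ and $v$ with $u\le_L v$ and all inner vertices $w$ satisfying $v<_Lw$; $\mathrm{SReach}_r[G,L,v]$ is the set of such $u$, and $\mathrm{col}_r(G)=\min_L\max_v|\mathrm{SReach}_r[G,L,v]|$ over all linear orders $L$ of $V(G)$. -}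

module Defs where

open import Data.Nat using (ℕ; zero; suc; _≤_; _<_)
open import Data.Fin using (Fin; toℕ)
open import Data.List using (List; length)
open import Data.List.Relation.Unary.All using (All)
open import Data.List.Relation.Unary.Unique.Propositional using (Unique)
open import Data.Product using (Σ; ∃; _×_)
open import Relation.Binary.PropositionalEquality using (_≡_)
open import Relation.Nullary using (¬_)
open import Function.Definitions using (Injective)

record Graph : Set₁ where
  field
    n     : ℕ
    Adj   : Fin n → Fin n → Set
    sym   : ∀ {x y} → Adj x y → Adj y x
    irrefl : ∀ {x} → ¬ Adj x x

-- |{x ∈ A | P x}| ≤ m : every duplicate-free list of elements satisfying P
-- has length at most m.
AtMost : {A : Set} → ℕ → (A → Set) → Set
AtMost {A} m P = (xs : List A) → Unique xs → All P xs → length xs ≤ m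

module _ (G : Graph) where
  open Graph G

  -- Walk G P r x y : a walk of length at most r from x to y in G all of
  -- whose inner vertices satisfy P (endpoints unrestricted).
  data Walk (P : Fin n → Set) : ℕ → Fin n → Fin n → Set where
    here : ∀ {r x} → Walk P r x x
    edge : ∀ {r x y} → Adj x y → Walk P (suc r) x y
    step : ∀ {r x y z} → Adj x y → P y → Walk P r y z → Walk P (suc r) x z

  -- Distance in the induced subgraph G[S]: x, y ∈ S and a walk of length
  -- at most r inside S.
  InBall : (S : Fin n → Set) → ℕ → Fin n → Fin n → Set
  InBall S r v u = S v × S u × Walk S r v u

  -- Decompositions.  A decomposition (H_1,…,H_ℓ) is given by the map
  -- part : V(G) → Fin ℓ sending each vertex to the index of the unique
  -- H_i containing it (0-indexed); each part is non-empty.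
  record Decomposition : Set where
    field
      ℓ        : ℕ
      part     : Fin n → Fin ℓ
      nonempty : (i : Fin ℓ) → ∃ λ v → part v ≡ i

  module _ (D : Decomposition) where
    open Decomposition D

    -- vertex set of G - ⋃_{j<i} V(H_j)
    Remaining : Fin ℓ → Fin n → Set
    Remaining i v = toℕ i ≤ toℕ (part v)

    Spreads : (ℕ → ℕ) → Fin ℓ → Set
    Spreads f i = (r : ℕ) (v : Fin n) → Remaining i v →
      AtMost (f r) (λ u → InBall (Remaining i) r v u × part u ≡ i)

    IsFlat : (ℕ → ℕ) → Set
    IsFlat f = (i : Fin ℓ) → Spreads f i

    -- H_j (for j < i) is connected to the component of
    -- G - ⋃_{j<i} V(H_j) containing c.
    ConnectedTo : Fin ℓ → Fin n → Fin ℓ → Set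
    ConnectedTo i c j = toℕ j < toℕ i ×
      Σ (Fin n) λ x → Σ (Fin n) λ y →
        (Σ ℕ λ m → InBall (Remaining i) m c x) × Adj x y × part y ≡ j

    -- width ≤ k : every component C of G - ⋃_{j<i} V(H_j) (C = the
    -- component of some vertex c) is connected to at most k of H_1..H_{i-1}.
    WidthAtMost : ℕ → Set
    WidthAtMost k = (i : Fin ℓ) (c : Fin n) → Remaining i c →
      AtMost k (ConnectedTo i c)

  record LinearOrder : Set where
    field
      rank : Fin n → ℕ
      inj  : Injective _≡_ _≡_ rank

  module _ (L : LinearOrder) where
    open LinearOrder L

    SReach : ℕ → Fin n → Fin n → Set
    SReach r v u = rank u ≤ rank v ×
      Walk (λ w → rank v < rank w) r v u

  -- col_r(G) ≤ b  (col_r is a minimum over linear orders of a maximum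
  -- over vertices, so this unfolds to: some order achieves max ≤ b).
  ColAtMost : ℕ → ℕ → Set
  ColAtMost r b = Σ LinearOrder λ L → (v : Fin n) → AtMost b (SReach L r v)

module Submission where

-- Order V(G)
-- so that every vertex of H_j precedes every vertex of H_{j'} for j < j'
-- (ties broken by vertex index).  Fix v ∈ V(H_i) and let u be strongly
-- r-reachable from v via a path Q.  Then u lies in some H_j with j ≤ i,
-- and every inner vertex of Q lies in G_i = G - ⋃_{j<i} V(H_j).  Hence
--   * the reachable vertices of H_j lie in the r-ball of v in G_j, so there
--     are at most f(r) of them (flatness);
--   * if j < i, then Q leaves G_i through an edge into H_j, so H_j is
--     connected to the component of v in G_i; by the width bound this
--     happens for at most k indices j.
-- Counting over the labels i and the at most k connected labels gives
-- |SReach_r[v]| ≤ f(r) + k·f(r).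

open import Defs
open import Data.Nat using (ℕ; suc; _+_; _*_; _≤_; _<_; z≤n)
open import Data.Nat.Properties
open import Data.List using (List; []; _∷_; length; filter; map; deduplicate)
open import Data.List.Membership.Propositional using (_∈_)
open import Data.List.Membership.Propositional.Properties using (∈-map⁺; ∈-deduplicate⁺)
open import Data.List.Relation.Unary.All as All using (All; []; _∷_)
import Data.List.Relation.Unary.All.Properties as AllP
open import Data.List.Relation.Unary.Any using (here; there)
import Data.List.Relation.Unary.Unique.DecPropositional.Properties as UniqueDec
import Data.List.Relation.Unary.Unique.Propositional.Properties as UniqueP
open import Data.Product using (Σ; _×_; _,_; proj₁; proj₂)
open import Data.Fin using (Fin; toℕ) renaming (_≟_ to _≟ᶠ_)
open import Data.Fin.Properties using (toℕ-injective; toℕ<n)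
open import Data.Empty using (⊥-elim)
open import Relation.Binary.Definitions using (DecidableEquality)
open import Relation.Binary.PropositionalEquality using (_≡_; refl; sym; trans; cong)
open import Relation.Nullary using (¬_; yes; no; ¬?)
open import Relation.Unary using (Decidable)
open import Function using (_∘_)

AtMost-mono : {A : Set} {P P′ : A → Set} {m : ℕ} →
  (∀ {x} → P x → P′ x) → AtMost m P′ → AtMost m P
AtMost-mono P⊆P′ bound xs unique all = bound xs unique (All.map P⊆P′ all)

length-filter-split : {A : Set} {R : A → Set} (R? : Decidable R) (xs : List A) →
  length xs ≡ length (filter R? xs) + length (filter (¬? ∘ R?) xs)
length-filter-split R? [] = refl
length-filter-split R? (x ∷ xs) with R? x
... | yes _ = cong suc (length-filter-split R? xs)
... | no _ = trans (cong suc (length-filter-split R? xs)) (sym (+-suc _ _))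

split-count : {A : Set} {P R : A → Set} (R? : Decidable R) {a b : ℕ} →
  AtMost a (λ x → P x × R x) → AtMost b (λ x → P x × ¬ R x) → AtMost (a + b) P
split-count R? {a} {b} inside outside xs unique all = begin
    length xs                                            ≡⟨ length-filter-split R? xs ⟩
    length (filter R? xs) + length (filter (¬? ∘ R?) xs) ≤⟨ +-mono-≤ in-bound out-bound ⟩
    a + b                                                ∎
  where
  open ≤-Reasoning
  in-bound : length (filter R? xs) ≤ a
  in-bound = inside (filter R? xs) (UniqueP.filter⁺ R? unique)
    (All.zip (AllP.filter⁺ R? all , AllP.all-filter R? xs))
  out-bound : length (filter (¬? ∘ R?) xs) ≤ b
  out-bound = outside (filter (¬? ∘ R?) xs) (UniqueP.filter⁺ (¬? ∘ R?) unique)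
    (All.zip (AllP.filter⁺ (¬? ∘ R?) all , AllP.all-filter (¬? ∘ R?) xs))

module _ {A B : Set} (_≟_ : DecidableEquality B) (g : A → B) {Q : A → Set} {m : ℕ} where

  covered-count : (bs : List B) → (∀ {b} → b ∈ bs → AtMost m (λ x → Q x × g x ≡ b)) →
    AtMost (length bs * m) (λ x → Q x × g x ∈ bs)
  covered-count [] fibre [] unique all = z≤n
  covered-count [] fibre (x ∷ xs) unique ((_ , ()) ∷ _)
  covered-count (b ∷ bs) fibre = split-count (λ x → g x ≟ b)
    (AtMost-mono (λ { ((q , _) , gx≡b) → q , gx≡b }) (fibre (here refl)))
    (AtMost-mono label-in-rest (covered-count bs (fibre ∘ there)))
    where
    label-in-rest : ∀ {x} → (Q x × g x ∈ b ∷ bs) × ¬ g x ≡ b → Q x × g x ∈ bs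
    label-in-rest ((q , here gx≡b) , gx≢b) = ⊥-elim (gx≢b gx≡b)
    label-in-rest ((q , there gx∈bs) , _) = q , gx∈bs

  fibre-count : {P : B → Set} {k : ℕ} → AtMost k P →
    (∀ b → P b → AtMost m (λ x → Q x × g x ≡ b)) →
    AtMost (k * m) (λ x → Q x × P (g x))
  fibre-count {P} {k} boundP fibre xs unique all = begin
    length xs          ≤⟨ covered-count labels (fibre _ ∘ All.lookup labels-P) xs unique covered ⟩
    length labels * m  ≤⟨ *-monoˡ-≤ m (boundP labels (UniqueDec.deduplicate-! _≟_ _) labels-P) ⟩
    k * m              ∎
    where
    open ≤-Reasoning
    labels : List B
    labels = deduplicate _≟_ (map g xs)
    labels-P : All P labels
    labels-P = AllP.deduplicate⁺ _≟_ (AllP.map⁺ (All.map proj₂ all))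
    covered : All (λ x → Q x × g x ∈ labels) xs
    covered = All.tabulate λ x∈xs →
      proj₁ (All.lookup all x∈xs) , ∈-deduplicate⁺ _≟_ (∈-map⁺ g x∈xs)

lex-< : ∀ {n a b} x y → x < n → a < b → a * n + x < b * n + y
lex-< {n} {a} {b} x y x<n a<b = begin-strict
    a * n + x   <⟨ +-monoʳ-< (a * n) x<n ⟩
    a * n + n   ≡⟨ +-comm (a * n) n ⟩
    suc a * n   ≤⟨ *-monoˡ-≤ n a<b ⟩
    b * n       ≤⟨ m≤m+n (b * n) y ⟩
    b * n + y   ∎
  where open ≤-Reasoning

module _ (G : Graph) where
  open Graph G using (n; Adj)

  walk-mono : ∀ {P P′ : Fin n → Set} {m x y} → (∀ {w} → P w → P′ w) →
    Walk G P m x y → Walk G P′ m x y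
  walk-mono P⊆P′ here = here
  walk-mono P⊆P′ (edge a) = edge a
  walk-mono P⊆P′ (step a p w) = step a (P⊆P′ p) (walk-mono P⊆P′ w)

  exit-edge : ∀ {P R : Fin n → Set} {m v u} → (∀ {w} → P w → R w) →
    Walk G P m v u → R v → ¬ R u →
    Σ (Fin n) λ x → Σ ℕ λ m′ → Walk G R m′ v x × R x × Adj x u
  exit-edge P⊆R here Rv ¬Ru = ⊥-elim (¬Ru Rv)
  exit-edge {v = v} P⊆R (edge a) Rv ¬Ru = v , 0 , here , Rv , a
  exit-edge P⊆R (step a p w) Rv ¬Ru with exit-edge P⊆R w (P⊆R p) ¬Ru
  ... | x , m′ , w′ , Rx , ax = x , suc m′ , step a (P⊆R p) w′ , Rx , ax

  module _ (D : Decomposition G) where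
    open Decomposition D

    -- The order listing H_1, H_2, … one after another.
    rank : Fin n → ℕ
    rank v = toℕ (part v) * n + toℕ v

    rank-≤⇒part-≤ : ∀ a b → rank a ≤ rank b → toℕ (part a) ≤ toℕ (part b)
    rank-≤⇒part-≤ a b ra≤rb = ≮⇒≥ λ pb<pa → <⇒≱ (lex-< (toℕ b) (toℕ a) (toℕ<n b) pb<pa) ra≤rb

    rank-injective : ∀ a b → rank a ≡ rank b → a ≡ b
    rank-injective a b ra≡rb = toℕ-injective (+-cancelˡ-≡ (toℕ (part a) * n) _ _ same-block)
      where
      pa≡pb : toℕ (part a) ≡ toℕ (part b)
      pa≡pb = ≤-antisym (rank-≤⇒part-≤ a b (≤-reflexive ra≡rb))
                        (rank-≤⇒part-≤ b a (≤-reflexive (sym ra≡rb)))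
      same-block : toℕ (part a) * n + toℕ a ≡ toℕ (part a) * n + toℕ b
      same-block = trans ra≡rb (cong (λ t → t * n + toℕ b) (sym pa≡pb))

    decomposition-order : LinearOrder G
    decomposition-order = record { rank = rank ; inj = λ {a} {b} → rank-injective a b }

    -- From now on v is a vertex of H_i, i.e. i = part v.
    module _ (r : ℕ) (v : Fin n) where

      SR : Fin n → Set
      SR = SReach G decomposition-order r v

      inner-remaining : ∀ {w} → rank v < rank w → Remaining G D (part v) w
      inner-remaining {w} rv<rw = rank-≤⇒part-≤ v w (<⇒≤ rv<rw)

      sreach-ball : ∀ {u j} → SR u → part u ≡ j → InBall G (Remaining G D j) r v u
      sreach-ball {u} (ru≤rv , path) refl =
        j≤i , ≤-refl , walk-mono (λ rv<rw → ≤-trans j≤i (inner-remaining rv<rw)) path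
        where
        j≤i : toℕ (part u) ≤ toℕ (part v)
        j≤i = rank-≤⇒part-≤ u v ru≤rv

      sreach-fibre : {f : ℕ → ℕ} → IsFlat G D f → ∀ j → toℕ j ≤ toℕ (part v) →
        AtMost (f r) (λ u → SR u × part u ≡ j)
      sreach-fibre flat j j≤i =
        AtMost-mono (λ { (s , pu≡j) → sreach-ball s pu≡j , pu≡j }) (flat j r v j≤i)

      sreach-earlier : ∀ {u} → SR u → ¬ part u ≡ part v → toℕ (part u) < toℕ (part v)
      sreach-earlier {u} (ru≤rv , _) pu≢pv =
        ≤∧≢⇒< (rank-≤⇒part-≤ u v ru≤rv) (pu≢pv ∘ toℕ-injective)

      -- Its strong path leaves G_i through an edge into its part H_j, so H_j
      -- is connected to the component of v in G_i.
      sreach-connected : ∀ {u} → SR u → ¬ part u ≡ part v →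
        ConnectedTo G D (part v) v (part u)
      sreach-connected {u} s@(_ , path) pu≢pv
        with pu<pv ← sreach-earlier s pu≢pv
        with x , m′ , inside , Rx , xu ← exit-edge inner-remaining path ≤-refl (<⇒≱ pu<pv)
        = pu<pv , x , u , (m′ , ≤-refl , Rx , inside) , xu , refl

      -- |SReach_r[v]| ≤ f(r) + k·f(r): at most f(r) vertices in H_i, and the
      -- others lie in the at most k parts connected to the component of v.
      sreach-bound : {f : ℕ → ℕ} {k : ℕ} → IsFlat G D f → WidthAtMost G D k →
        AtMost (suc k * f r) SR
      sreach-bound flat width = split-count (λ u → part u ≟ᶠ part v)
        (sreach-fibre flat (part v) ≤-refl)
        (AtMost-mono (λ { (s , pu≢pv) → s , sreach-connected s pu≢pv })
          (fibre-count _≟ᶠ_ part (width (part v) v ≤-refl)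
            λ j connected → sreach-fibre flat j (<⇒≤ (proj₁ connected))))

lemma3p4 : (f : ℕ → ℕ) (r k : ℕ) (G : Graph) (D : Decomposition G) →
    IsFlat G D f → WidthAtMost G D k →
    ColAtMost G r (suc k * f r)
lemma3p4 f r k G D flat width =
  decomposition-order G D , λ v → sreach-bound G D r v flat width
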